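{- Let $r$ be an indeterminate. Then $$\mathcal{P}\!\left(\frac{1-(r+1)x}{(1-x)(1-rx)}\right)=\frac{1}{1+r(e^x-1)}.$$
   Context: For a formal power series $g(x)=\sum_{n\ge0} g_n x^n$ with $g_0=1$ and $g_1\neq 1$, the transformation pipeline $\mathcal{P}$ is defined by: (1) $\tilde g(t)=\sum_{n\ge0} g_n \frac{t^n}{n!}$ (inverse Sumudu transform); (2) $h(t)=\tilde g'(t)/\tilde g(t)$; (3) $\varphi(z)=\int_0^z (1-h(t))\,dt=z-\ln\tilde g(z)$; (4) letting $\psi$ be the compositional inverse of $\varphi$ ($\psi(0)=0$, $\varphi(\psi(x))=x$), set $\mathcal{P}(g)(x)=\psi'(x)$. Identities are of formal power series. -}

module Defs where

open import Data.Nat as ℕ using (ℕ; zero; suc; _∸_; _!)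
open import Data.Nat.Properties using (_!≢0)
import Data.Integer as ℤ
open import Data.Rational as ℚ using (ℚ; 0ℚ; 1ℚ)
open import Relation.Binary.PropositionalEquality using (_≡_)

-- Coefficient ring: ℚ[[r]], power series in the indeterminate r over ℚ,
-- represented by coefficient sequences.  (ℚ[r] ⊂ ℚ[[r]], so identities
-- of series in x over ℚ[r] are the same as over ℚ[[r]].)

Coef : Set
Coef = ℕ → ℚ

sumQ : ℕ → (ℕ → ℚ) → ℚ
sumQ zero    f = f 0
sumQ (suc n) f = sumQ n f ℚ.+ f (suc n)

0ᶜ : Coef
0ᶜ _ = 0ℚ

1ᶜ : Coef
1ᶜ zero    = 1ℚ
1ᶜ (suc _) = 0ℚ

rᶜ : Coef
rᶜ 1 = 1ℚ
rᶜ _ = 0ℚ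

_+ᶜ_ : Coef → Coef → Coef
(a +ᶜ b) k = a k ℚ.+ b k

-ᶜ_ : Coef → Coef
(-ᶜ a) k = ℚ.- (a k)

_*ᶜ_ : Coef → Coef → Coef
(a *ᶜ b) k = sumQ k (λ i → a i ℚ.* b (k ∸ i))

_·ᶜ_ : ℚ → Coef → Coef
(q ·ᶜ a) k = q ℚ.* a k

invFact : ℕ → ℚ
invFact n = (ℤ.+ 1) ℚ./ (n !)
  where instance _ = n !≢0

invSuc : ℕ → ℚ
invSuc n = (ℤ.+ 1) ℚ./ (suc n)

FPS : Set
FPS = ℕ → Coef

_≈_ : FPS → FPS → Set
f ≈ g = ∀ n k → f n k ≡ g n k

infix 4 _≈_

sumC : ℕ → (ℕ → Coef) → Coef
sumC zero    f = f 0
sumC (suc n) f = sumC n f +ᶜ f (suc n)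

const : Coef → FPS
const c zero    = c
const c (suc _) = 0ᶜ

𝟘 𝟙 : FPS
𝟘 = const 0ᶜ
𝟙 = const 1ᶜ

X : FPS
X 1 = 1ᶜ
X _ = 0ᶜ

R : FPS
R = const rᶜ

_+_ : FPS → FPS → FPS
(f + g) n = f n +ᶜ g n

-_ : FPS → FPS
(- f) n = -ᶜ (f n)

_-_ : FPS → FPS → FPS
f - g = f + (- g)

_*_ : FPS → FPS → FPS
(f * g) n = sumC n (λ i → f i *ᶜ g (n ∸ i))

infixl 6 _+_ _-_
infixl 7 _*_
infix 8 -_

_^_ : FPS → ℕ → FPS
f ^ zero  = 𝟙
f ^ suc k = f * (f ^ k)

-- composition f ∘ g (meaningful when g has zero constant term):
-- (f ∘ g)_n = Σ_{k=0}^{n} f_k (g^k)_n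
_∘ₛ_ : FPS → FPS → FPS
(f ∘ₛ g) n = sumC n (λ k → f k *ᶜ (g ^ k) n)

D : FPS → FPS
D f n = ((ℤ.+ suc n) ℚ./ 1) ·ᶜ f (suc n)

∫ : FPS → FPS
∫ f zero    = 0ᶜ
∫ f (suc n) = invSuc n ·ᶜ f n

expX : FPS
expX n = invFact n ·ᶜ 1ᶜ

-- step (1): inverse Sumudu (Borel) transform  Σ g_n x^n ↦ Σ g_n t^n / n!
borel : FPS → FPS
borel g n = invFact n ·ᶜ g n

module Submission where

-- The statement encodes each step by its defining
-- equation: g (1 - x)(1 - rx) = 1 - (1 + r)x;  h G = G' for the Borel
-- transform G of g;  (∫ (1 - h)) ∘ ψ = x with ψ₀ = 0.  The claim is
-- ψ' · (1 + r(eˣ - 1)) = 1.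
--
-- Idea.  The denominator gives g_{n+2} = (1 + r) g_{n+1} - r g_n, i.e.
-- G'' = (1 + r) G' - r G.  Hence h = G'/G obeys a Riccati equation, and
-- q = 1 - h obeys q' = q² + (r - 1) q.  Differentiating (∫ q) ∘ ψ = x gives
-- Q ψ' = 1 for Q = q ∘ ψ, and the chain rule turns the Riccati equation into
-- the linear equation Q' = Q + (r - 1).  E = 1 + r(eˣ - 1) solves the same
-- equation with the same constant term 1, so Q = E and ψ' E = 1.

open import Algebra using (CommutativeRing; RawRing)
open import Data.Maybe using (Maybe; just; nothing)
open import Data.Nat as ℕ using (ℕ; zero; suc; _∸_; _≤_; _<_; z≤n; s≤s)
import Data.Nat.Properties as ℕₚ
open import Data.Product using (_,_)
import Data.Product.Properties as ×ₚ
open import Data.Sum using (inj₁; inj₂)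
open import Relation.Binary.PropositionalEquality as ≡ using (_≡_)
open import Relation.Nullary using (yes; no)
import Algebra.Solver.Ring.NaturalCoefficients.Default

-- The standard library's `Algebra.Solver.Ring` needs a
-- coefficient ring mapping into the target ring with a (weakly)
-- decidable equality; we supply the integers, represented as
-- differences a - b of naturals kept in the normal form where one side
-- is zero, interpreted as a·1 - b·1.
module IntegerSolver {c ℓ} (R : CommutativeRing c ℓ) where
  open CommutativeRing R
  open import Algebra.Properties.Semiring.Mult.TCOptimised semiring using (_×_; 1+×; ×-homo-+; ×1-homo-*)
  open import Algebra.Properties.Ring ring using (-‿distribˡ-*; -‿distribʳ-*; -‿involutive; -‿+-comm; -0#≈0#)
  open import Algebra.Solver.Ring.AlmostCommutativeRing
    using (fromCommutativeRing; _-Raw-AlmostCommutative⟶_)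
  open import Relation.Binary.Reasoning.Setoid setoid
  import Data.Product as ×

  Diff : Set
  Diff = ℕ ×.× ℕ

  canonical : ℕ → ℕ → Diff
  canonical a b = (a ∸ b , b ∸ a)

  diffRawRing : RawRing _ _
  diffRawRing = record
    { Carrier = Diff ; _≈_ = _≡_
    ; _+_ = λ { (a , b) (c , d) → canonical (a ℕ.+ c) (b ℕ.+ d) }
    ; _*_ = λ { (a , b) (c , d) → canonical (a ℕ.* c ℕ.+ b ℕ.* d) (a ℕ.* d ℕ.+ b ℕ.* c) }
    ; -_ = λ { (a , b) → (b , a) }
    ; 0# = (0 , 0) ; 1# = (1 , 0) }

  -- a·1 - b·1, arranged so that the constants 0 and 1 denote 0# and 1#
  -- definitionally (the solver's `refl` proofs rely on this)
  ⟦_⟧ℤ : Diff → Carrier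
  ⟦ (a , zero)  ⟧ℤ = a × 1#
  ⟦ (a , suc b) ⟧ℤ = a × 1# - suc b × 1#

  module ℕSolver = Algebra.Solver.Ring.NaturalCoefficients.Default commutativeSemiring

  sub-+ : ∀ A B C D → (A + C) - (B + D) ≈ (A - B) + (C - D)
  sub-+ A B C D = begin
    (A + C) - (B + D)     ≈⟨ +-congˡ (sym (-‿+-comm B D)) ⟩
    (A + C) + (- B + - D) ≈⟨ solve 4 (λ a b c d → (a :+ c) :+ (b :+ d) := (a :+ b) :+ (c :+ d)) refl A (- B) C (- D) ⟩
    (A - B) + (C - D)     ∎
    where open ℕSolver using (solve; _:+_; _:=_)

  sub-* : ∀ A B C D → (A * C + B * D) - (A * D + B * C) ≈ (A - B) * (C - D)
  sub-* A B C D = begin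
    (A * C + B * D) - (A * D + B * C)           ≈⟨ +-congˡ (sym (-‿+-comm _ _)) ⟩
    (A * C + B * D) + (- (A * D) + - (B * C))   ≈⟨ +-cong (+-congˡ (sym neg-neg)) (+-cong (-‿distribʳ-* A D) (-‿distribˡ-* B C)) ⟩
    (A * C + - B * - D) + (A * - D + - B * C)   ≈⟨ solve 4 (λ a b c d → (a :* c :+ b :* d) :+ (a :* d :+ b :* c) := (a :+ b) :* (c :+ d)) refl A (- B) C (- D) ⟩
    (A - B) * (C - D)                           ∎
    where
    open ℕSolver using (solve; _:+_; _:*_; _:=_)
    neg-neg : - B * - D ≈ B * D
    neg-neg = trans (sym (-‿distribˡ-* B (- D))) (trans (-‿cong (sym (-‿distribʳ-* B D))) (-‿involutive _))

  sub-swap : ∀ A B → B - A ≈ - (A - B)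
  sub-swap A B = begin
    B - A       ≈⟨ +-comm B (- A) ⟩
    - A + B     ≈⟨ +-congˡ (sym (-‿involutive B)) ⟩
    - A + - - B ≈⟨ -‿+-comm A (- B) ⟩
    - (A - B)   ∎

  sub-suc : ∀ x y → x - y ≈ (1# + x) - (1# + y)
  sub-suc x y = begin
    x - y                 ≈⟨ sym (+-identityˡ _) ⟩
    0# + (x - y)          ≈⟨ +-congʳ (sym (-‿inverseʳ 1#)) ⟩
    (1# - 1#) + (x - y)   ≈⟨ sym (sub-+ 1# 1# x y) ⟩
    (1# + x) - (1# + y)   ∎

  ⟦⟧ℤ-diff : ∀ a b → ⟦ (a , b) ⟧ℤ ≈ a × 1# - b × 1#
  ⟦⟧ℤ-diff a zero    = sym (trans (+-congˡ -0#≈0#) (+-identityʳ _))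
  ⟦⟧ℤ-diff a (suc b) = refl

  canonical-sound : ∀ a b → ⟦ canonical a b ⟧ℤ ≈ a × 1# - b × 1#
  canonical-sound zero    zero    = ⟦⟧ℤ-diff 0 0
  canonical-sound zero    (suc b) = ⟦⟧ℤ-diff 0 (suc b)
  canonical-sound (suc a) zero    = ⟦⟧ℤ-diff (suc a) 0
  canonical-sound (suc a) (suc b) = begin
    ⟦ canonical a b ⟧ℤ                  ≈⟨ canonical-sound a b ⟩
    a × 1# - b × 1#                     ≈⟨ sub-suc _ _ ⟩
    (1# + a × 1#) - (1# + b × 1#)       ≈⟨ sym (+-cong (1+× a 1#) (-‿cong (1+× b 1#))) ⟩
    suc a × 1# - suc b × 1#             ∎

  ⟦⟧ℤ-homomorphism : diffRawRing -Raw-AlmostCommutative⟶ fromCommutativeRing R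
  ⟦⟧ℤ-homomorphism = record
    { ⟦_⟧ = ⟦_⟧ℤ
    ; +-homo = λ { (a , b) (c , d) → begin
        ⟦ canonical (a ℕ.+ c) (b ℕ.+ d) ⟧ℤ         ≈⟨ canonical-sound (a ℕ.+ c) (b ℕ.+ d) ⟩
        (a ℕ.+ c) × 1# - (b ℕ.+ d) × 1#           ≈⟨ +-cong (×-homo-+ 1# a c) (-‿cong (×-homo-+ 1# b d)) ⟩
        (a × 1# + c × 1#) - (b × 1# + d × 1#)     ≈⟨ sub-+ _ _ _ _ ⟩
        (a × 1# - b × 1#) + (c × 1# - d × 1#)     ≈⟨ sym (+-cong (⟦⟧ℤ-diff a b) (⟦⟧ℤ-diff c d)) ⟩
        ⟦ (a , b) ⟧ℤ + ⟦ (c , d) ⟧ℤ                 ∎ }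
    ; *-homo = λ { (a , b) (c , d) → begin
        ⟦ canonical (a ℕ.* c ℕ.+ b ℕ.* d) (a ℕ.* d ℕ.+ b ℕ.* c) ⟧ℤ
          ≈⟨ canonical-sound (a ℕ.* c ℕ.+ b ℕ.* d) (a ℕ.* d ℕ.+ b ℕ.* c) ⟩
        (a ℕ.* c ℕ.+ b ℕ.* d) × 1# - (a ℕ.* d ℕ.+ b ℕ.* c) × 1#
          ≈⟨ +-cong (×-homo-+·× a c b d) (-‿cong (×-homo-+·× a d b c)) ⟩
        ((a × 1#) * (c × 1#) + (b × 1#) * (d × 1#)) - ((a × 1#) * (d × 1#) + (b × 1#) * (c × 1#))
          ≈⟨ sub-* _ _ _ _ ⟩
        (a × 1# - b × 1#) * (c × 1# - d × 1#)
          ≈⟨ sym (*-cong (⟦⟧ℤ-diff a b) (⟦⟧ℤ-diff c d)) ⟩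
        ⟦ (a , b) ⟧ℤ * ⟦ (c , d) ⟧ℤ ∎ }
    ; -‿homo = λ { (a , b) → begin
        ⟦ (b , a) ⟧ℤ        ≈⟨ ⟦⟧ℤ-diff b a ⟩
        b × 1# - a × 1#     ≈⟨ sub-swap (a × 1#) (b × 1#) ⟩
        - (a × 1# - b × 1#) ≈⟨ -‿cong (sym (⟦⟧ℤ-diff a b)) ⟩
        - ⟦ (a , b) ⟧ℤ      ∎ }
    ; 0-homo = refl
    ; 1-homo = refl
    }
    where
    ×-homo-+·× : ∀ a c b d → (a ℕ.* c ℕ.+ b ℕ.* d) × 1# ≈ (a × 1#) * (c × 1#) + (b × 1#) * (d × 1#)
    ×-homo-+·× a c b d = trans (×-homo-+ 1# (a ℕ.* c) (b ℕ.* d)) (+-cong (×1-homo-* a c) (×1-homo-* b d))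

  _≟-diff_ : ∀ x y → Maybe (⟦ x ⟧ℤ ≈ ⟦ y ⟧ℤ)
  x ≟-diff y with ×ₚ.≡-dec ℕₚ._≟_ ℕₚ._≟_ x y
  ... | yes ≡.refl = just refl
  ... | no _       = nothing

  open import Algebra.Solver.Ring diffRawRing (fromCommutativeRing R) ⟦⟧ℤ-homomorphism _≟-diff_ public
    using (solve; Polynomial; con; _:+_; _:*_; _:-_; :-_; _:=_)

  :0 :1 : ∀ {n} → Polynomial n
  :0 = con (0 , 0)
  :1 = con (1 , 0)

module RationalArithmetic where
  open import Data.Nat using (NonZero)
  open import Data.Rational as ℚ using (ℚ; toℚᵘ; 1ℚ)
  import Data.Rational.Properties as ℚₚ
  import Data.Rational.Unnormalised as ℚᵘ
  import Data.Rational.Unnormalised.Properties as ℚᵘₚ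
  import Data.Integer as ℤ
  import Data.Integer.Properties as ℤₚ
  open ≡.≡-Reasoning

  N : ℕ → ℚ
  N n = (ℤ.+ n) ℚ./ 1

  toℚᵘ-/ : ∀ i d .{{_ : NonZero d}} → toℚᵘ (i ℚ./ d) ℚᵘ.≃ (i ℚᵘ./ d)
  toℚᵘ-/ i (suc d) = ℚₚ.toℚᵘ-fromℚᵘ (ℚᵘ.mkℚᵘ i d)

  N-+ : ∀ a b → N (a ℕ.+ b) ≡ N a ℚ.+ N b
  N-+ a b = ℚₚ.toℚᵘ-injective (ℚᵘₚ.≃-trans (toℚᵘ-/ (ℤ.+ (a ℕ.+ b)) 1)
    (ℚᵘₚ.≃-trans unnormalised (ℚᵘₚ.≃-sym (ℚᵘₚ.≃-trans (ℚₚ.toℚᵘ-homo-+ (N a) (N b))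
      (ℚᵘₚ.+-cong (toℚᵘ-/ (ℤ.+ a) 1) (toℚᵘ-/ (ℤ.+ b) 1))))))
    where
    unnormalised : (ℤ.+ (a ℕ.+ b)) ℚᵘ./ 1 ℚᵘ.≃ ((ℤ.+ a) ℚᵘ./ 1) ℚᵘ.+ ((ℤ.+ b) ℚᵘ./ 1)
    unnormalised = ℚᵘ.*≡* (begin
      ℤ.+ (a ℕ.+ b) ℤ.* ℤ.+ 1                          ≡⟨ ℤₚ.*-identityʳ _ ⟩
      ℤ.+ (a ℕ.+ b)                                    ≡⟨ ℤₚ.pos-+ a b ⟩
      ℤ.+ a ℤ.+ ℤ.+ b                                  ≡⟨ ≡.sym (≡.cong₂ ℤ._+_ (ℤₚ.*-identityʳ (ℤ.+ a)) (ℤₚ.*-identityʳ (ℤ.+ b))) ⟩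
      ℤ.+ a ℤ.* ℤ.+ 1 ℤ.+ ℤ.+ b ℤ.* ℤ.+ 1              ≡⟨ ≡.sym (ℤₚ.*-identityʳ _) ⟩
      (ℤ.+ a ℤ.* ℤ.+ 1 ℤ.+ ℤ.+ b ℤ.* ℤ.+ 1) ℤ.* ℤ.+ 1  ∎)

  -- a · (1/b) = 1/c whenever a·c = b; this covers (n+1)·(1/(n+1)!) = 1/n!
  -- and (n+1)·(1/(n+1)) = 1
  N*reciprocal : ∀ a b c .{{_ : NonZero b}} .{{_ : NonZero c}} →
                 a ℕ.* c ≡ b → N a ℚ.* ((ℤ.+ 1) ℚ./ b) ≡ (ℤ.+ 1) ℚ./ c
  N*reciprocal a (suc b) (suc c) eq = ℚₚ.toℚᵘ-injective (ℚᵘₚ.≃-trans (ℚₚ.toℚᵘ-homo-* (N a) ((ℤ.+ 1) ℚ./ suc b))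
    (ℚᵘₚ.≃-trans (ℚᵘₚ.*-cong (toℚᵘ-/ (ℤ.+ a) 1) (toℚᵘ-/ (ℤ.+ 1) (suc b)))
    (ℚᵘₚ.≃-trans unnormalised (ℚᵘₚ.≃-sym (toℚᵘ-/ (ℤ.+ 1) (suc c))))))
    where
    unnormalised : ((ℤ.+ a) ℚᵘ./ 1) ℚᵘ.* ((ℤ.+ 1) ℚᵘ./ suc b) ℚᵘ.≃ (ℤ.+ 1) ℚᵘ./ suc c
    unnormalised = ℚᵘ.*≡* (begin
      (ℤ.+ a ℤ.* ℤ.+ 1) ℤ.* ℤ.+ suc c  ≡⟨ ≡.cong (ℤ._* ℤ.+ suc c) (ℤₚ.*-identityʳ (ℤ.+ a)) ⟩
      ℤ.+ a ℤ.* ℤ.+ suc c              ≡⟨ ≡.sym (ℤₚ.pos-* a (suc c)) ⟩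
      ℤ.+ (a ℕ.* suc c)                ≡⟨ ≡.cong ℤ.+_ eq ⟩
      ℤ.+ suc b                        ≡⟨ ≡.sym (ℤₚ.*-identityˡ (ℤ.+ suc b)) ⟩
      ℤ.+ 1 ℤ.* ℤ.+ suc b              ≡⟨ ≡.cong (λ m → ℤ.+ 1 ℤ.* ℤ.+ m) (≡.sym (ℕₚ.*-identityˡ (suc b))) ⟩
      ℤ.+ 1 ℤ.* ℤ.+ (1 ℕ.* suc b)      ∎)

  N-suc-cancel : ∀ n {x y} → N (suc n) ℚ.* x ≡ N (suc n) ℚ.* y → x ≡ y
  N-suc-cancel n {x} {y} eq = begin
    x                          ≡⟨ ≡.sym (ℚₚ.*-identityˡ x) ⟩
    1ℚ ℚ.* x                   ≡⟨ ≡.cong (ℚ._* x) (≡.sym inverse) ⟩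
    (i ℚ.* N (suc n)) ℚ.* x    ≡⟨ ℚₚ.*-assoc i _ x ⟩
    i ℚ.* (N (suc n) ℚ.* x)    ≡⟨ ≡.cong (i ℚ.*_) eq ⟩
    i ℚ.* (N (suc n) ℚ.* y)    ≡⟨ ≡.sym (ℚₚ.*-assoc i _ y) ⟩
    (i ℚ.* N (suc n)) ℚ.* y    ≡⟨ ≡.cong (ℚ._* y) inverse ⟩
    1ℚ ℚ.* y                   ≡⟨ ℚₚ.*-identityˡ y ⟩
    y                          ∎
    where
    i : ℚ
    i = (ℤ.+ 1) ℚ./ suc n
    inverse : i ℚ.* N (suc n) ≡ 1ℚ
    inverse = ≡.trans (ℚₚ.*-comm i _) (N*reciprocal (suc n) (suc n) 1 (ℕₚ.*-identityʳ (suc n)))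

-- The module is
-- parametrised by the finite-sum operator Σ_{i≤n} and by the unit series,
-- given through their defining equations, so that instantiating it at
-- the concrete sums of `Defs` reproduces the concrete product there
-- definitionally.
module PowerSeries {c ℓ} (R : CommutativeRing c ℓ)
  (sum : ℕ → (ℕ → CommutativeRing.Carrier R) → CommutativeRing.Carrier R)
  (sum-0 : ∀ f → CommutativeRing._≈_ R (sum 0 f) (f 0))
  (sum-suc : ∀ n f → CommutativeRing._≈_ R (sum (suc n) f) (CommutativeRing._+_ R (sum n f) (f (suc n))))
  (𝟏 : ℕ → CommutativeRing.Carrier R)
  (𝟏-0 : CommutativeRing._≈_ R (𝟏 0) (CommutativeRing.1# R))
  (𝟏-suc : ∀ n → CommutativeRing._≈_ R (𝟏 (suc n)) (CommutativeRing.0# R))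
  where
  open CommutativeRing R
  open import Algebra.Properties.Ring ring using (-‿distribʳ-*)
  open import Relation.Binary.Reasoning.Setoid setoid
  open import Algebra.Properties.Semiring.Mult semiring using (_×_; ×-homo-+)
  module BaseSolver = IntegerSolver R

  sum-cong : ∀ n {f g} → (∀ i → i ≤ n → f i ≈ g i) → sum n f ≈ sum n g
  sum-cong zero    f≈g = trans (sum-0 _) (trans (f≈g 0 z≤n) (sym (sum-0 _)))
  sum-cong (suc n) f≈g = trans (sum-suc n _)
    (trans (+-cong (sum-cong n (λ i i≤n → f≈g i (ℕₚ.m≤n⇒m≤1+n i≤n))) (f≈g (suc n) ℕₚ.≤-refl))
           (sym (sum-suc n _)))

  sum-cong′ : ∀ n {f g} → (∀ i → f i ≈ g i) → sum n f ≈ sum n g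
  sum-cong′ n f≈g = sum-cong n (λ i _ → f≈g i)

  sum-vanish : ∀ n {f} → (∀ i → i ≤ n → f i ≈ 0#) → sum n f ≈ 0#
  sum-vanish zero    f≈0 = trans (sum-0 _) (f≈0 0 z≤n)
  sum-vanish (suc n) f≈0 = trans (sum-suc n _)
    (trans (+-cong (sum-vanish n (λ i i≤n → f≈0 i (ℕₚ.m≤n⇒m≤1+n i≤n))) (f≈0 (suc n) ℕₚ.≤-refl))
           (+-identityˡ _))

  sum-+ : ∀ n f g → sum n (λ i → f i + g i) ≈ sum n f + sum n g
  sum-+ zero    f g = trans (sum-0 _) (sym (+-cong (sum-0 _) (sum-0 _)))
  sum-+ (suc n) f g = begin
    sum (suc n) (λ i → f i + g i)                  ≈⟨ sum-suc n _ ⟩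
    sum n (λ i → f i + g i) + (f (suc n) + g (suc n)) ≈⟨ +-congʳ (sum-+ n f g) ⟩
    (sum n f + sum n g) + (f (suc n) + g (suc n))  ≈⟨ solve 4 (λ a b c d → (a :+ b) :+ (c :+ d) := (a :+ c) :+ (b :+ d)) refl _ _ _ _ ⟩
    (sum n f + f (suc n)) + (sum n g + g (suc n))  ≈⟨ sym (+-cong (sum-suc n f) (sum-suc n g)) ⟩
    sum (suc n) f + sum (suc n) g                  ∎
    where open BaseSolver using (solve; _:+_; _:=_)

  sum-*ˡ : ∀ n a f → a * sum n f ≈ sum n (λ i → a * f i)
  sum-*ˡ zero    a f = trans (*-congˡ (sum-0 _)) (sym (sum-0 _))
  sum-*ˡ (suc n) a f = trans (*-congˡ (sum-suc n f))
    (trans (distribˡ a _ _) (trans (+-congʳ (sum-*ˡ n a f)) (sym (sum-suc n _))))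

  sum-*ʳ : ∀ n f a → sum n f * a ≈ sum n (λ i → f i * a)
  sum-*ʳ n f a = trans (*-comm _ _) (trans (sum-*ˡ n a f) (sum-cong′ n (λ i → *-comm _ _)))

  sum-head : ∀ n f → sum (suc n) f ≈ f 0 + sum n (λ i → f (suc i))
  sum-head zero    f = trans (sum-suc 0 f) (+-cong (sum-0 f) (sym (sum-0 _)))
  sum-head (suc n) f = begin
    sum (suc (suc n)) f                                    ≈⟨ sum-suc (suc n) f ⟩
    sum (suc n) f + f (suc (suc n))                        ≈⟨ +-congʳ (sum-head n f) ⟩
    (f 0 + sum n (λ i → f (suc i))) + f (suc (suc n))      ≈⟨ +-assoc _ _ _ ⟩
    f 0 + (sum n (λ i → f (suc i)) + f (suc (suc n)))      ≈⟨ +-congˡ (sym (sum-suc n _)) ⟩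
    f 0 + sum (suc n) (λ i → f (suc i))                    ∎

  sum-reverse : ∀ n f → sum n f ≈ sum n (λ i → f (n ∸ i))
  sum-reverse zero    f = trans (sum-0 f) (sym (sum-0 _))
  sum-reverse (suc n) f = begin
    sum (suc n) f                                       ≈⟨ sum-head n f ⟩
    f 0 + sum n (λ i → f (suc i))                       ≈⟨ +-congˡ (sum-reverse n (λ i → f (suc i))) ⟩
    f 0 + sum n (λ i → f (suc (n ∸ i)))                 ≈⟨ +-comm _ _ ⟩
    sum n (λ i → f (suc (n ∸ i))) + f 0                 ≈⟨ +-cong (sum-cong n (λ i i≤n → reflexive (≡.cong f (≡.sym (ℕₚ.+-∸-assoc 1 i≤n)))))
                                                                  (reflexive (≡.cong f (≡.sym (ℕₚ.n∸n≡0 n)))) ⟩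
    sum n (λ i → f (suc n ∸ i)) + f (suc n ∸ suc n)     ≈⟨ sym (sum-suc n _) ⟩
    sum (suc n) (λ i → f (suc n ∸ i))                   ∎

  sum-extend : ∀ {n} m f → n ≤ m → (∀ i → n < i → i ≤ m → f i ≈ 0#) → sum m f ≈ sum n f
  sum-extend zero    f z≤n _ = refl
  sum-extend (suc m) f n≤1+m f≈0 with ℕₚ.m≤n⇒m<n∨m≡n n≤1+m
  ... | inj₂ ≡.refl = refl
  ... | inj₁ n<1+m  = trans (sum-suc m f)
    (trans (+-cong (sum-extend m f (ℕₚ.m<1+n⇒m≤n n<1+m) (λ i n<i i≤m → f≈0 i n<i (ℕₚ.m≤n⇒m≤1+n i≤m)))
                   (f≈0 (suc m) n<1+m ℕₚ.≤-refl))
           (+-identityʳ _))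

  sum-swap : ∀ m n (F : ℕ → ℕ → Carrier) → sum m (λ k → sum n (F k)) ≈ sum n (λ i → sum m (λ k → F k i))
  sum-swap zero    n F = trans (sum-0 _) (sum-cong′ n (λ i → sym (sum-0 _)))
  sum-swap (suc m) n F = begin
    sum (suc m) (λ k → sum n (F k))                           ≈⟨ sum-suc m _ ⟩
    sum m (λ k → sum n (F k)) + sum n (F (suc m))             ≈⟨ +-congʳ (sum-swap m n F) ⟩
    sum n (λ i → sum m (λ k → F k i)) + sum n (F (suc m))     ≈⟨ sym (sum-+ n _ _) ⟩
    sum n (λ i → sum m (λ k → F k i) + F (suc m) i)           ≈⟨ sum-cong′ n (λ i → sym (sum-suc m _)) ⟩
    sum n (λ i → sum (suc m) (λ k → F k i))                   ∎

  Series : Set c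
  Series = ℕ → Carrier

  infix  4 _≋_
  infixl 6 _⊕_
  infixl 7 _⊛_

  _≋_ : Series → Series → Set ℓ
  f ≋ g = ∀ n → f n ≈ g n

  _⊕_ : Series → Series → Series
  (f ⊕ g) n = f n + g n

  ⊖_ : Series → Series
  (⊖ f) n = - f n

  𝟎 : Series
  𝟎 _ = 0#

  _⊛_ : Series → Series → Series
  (f ⊛ g) n = sum n (λ i → f i * g (n ∸ i))

  shift : Series → Series
  shift f n = f (suc n)

  cst : Carrier → Series
  cst a zero    = a
  cst a (suc _) = 0#

  ⊛-congₙ : ∀ n {f f′ g g′} → (∀ i → i ≤ n → f i ≈ f′ i) → (∀ i → i ≤ n → g i ≈ g′ i) →
            (f ⊛ g) n ≈ (f′ ⊛ g′) n
  ⊛-congₙ n f≈ g≈ = sum-cong n (λ i i≤n → *-cong (f≈ i i≤n) (g≈ (n ∸ i) (ℕₚ.m∸n≤m n i)))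

  ⊛-cong : ∀ {f f′ g g′} → f ≋ f′ → g ≋ g′ → f ⊛ g ≋ f′ ⊛ g′
  ⊛-cong f≈ g≈ n = ⊛-congₙ n (λ i _ → f≈ i) (λ i _ → g≈ i)

  ⊛-comm : ∀ f g → f ⊛ g ≋ g ⊛ f
  ⊛-comm f g n = begin
    sum n (λ i → f i * g (n ∸ i))               ≈⟨ sum-reverse n _ ⟩
    sum n (λ i → f (n ∸ i) * g (n ∸ (n ∸ i)))   ≈⟨ sum-cong n (λ i i≤n → trans (*-comm _ _) (*-congʳ (reflexive (≡.cong g (ℕₚ.m∸[m∸n]≡n i≤n))))) ⟩
    sum n (λ i → g i * f (n ∸ i))               ∎

  ⊛-distribʳ : ∀ f g h → (f ⊕ g) ⊛ h ≋ f ⊛ h ⊕ g ⊛ h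
  ⊛-distribʳ f g h n = trans (sum-cong′ n (λ i → distribʳ _ _ _)) (sum-+ n _ _)

  ⊛-distribˡ : ∀ f g h → h ⊛ (f ⊕ g) ≋ h ⊛ f ⊕ h ⊛ g
  ⊛-distribˡ f g h n = trans (sum-cong′ n (λ i → distribˡ _ _ _)) (sum-+ n _ _)

  ⊛-constantˡ : ∀ u v → (∀ i → u (suc i) ≈ 0#) → u ⊛ v ≋ (λ n → u 0 * v n)
  ⊛-constantˡ u v u≈0 zero    = sum-0 _
  ⊛-constantˡ u v u≈0 (suc n) = begin
    (u ⊛ v) (suc n)                                       ≈⟨ sum-head n _ ⟩
    u 0 * v (suc n) + sum n (λ i → u (suc i) * v (n ∸ i)) ≈⟨ +-congˡ (sum-vanish n (λ i _ → trans (*-congʳ (u≈0 i)) (zeroˡ _))) ⟩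
    u 0 * v (suc n) + 0#                                  ≈⟨ +-identityʳ _ ⟩
    u 0 * v (suc n)                                       ∎

  ⊛-identityˡ : ∀ g → 𝟏 ⊛ g ≋ g
  ⊛-identityˡ g n = trans (⊛-constantˡ 𝟏 g 𝟏-suc n) (trans (*-congʳ 𝟏-0) (*-identityˡ _))

  ⊛-shift : ∀ f g n → (f ⊛ g) (suc n) ≈ f 0 * g (suc n) + (shift f ⊛ g) n
  ⊛-shift f g n = sum-head n _

  ⊛-variable-0 : ∀ u f → u 0 ≈ 0# → (u ⊛ f) 0 ≈ 0#
  ⊛-variable-0 u f u₀≈0 = trans (sum-0 _) (trans (*-congʳ u₀≈0) (zeroˡ _))

  ⊛-variable-suc : ∀ u f → u 0 ≈ 0# → u 1 ≈ 1# → (∀ i → u (suc (suc i)) ≈ 0#) → ∀ n → (u ⊛ f) (suc n) ≈ f n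
  ⊛-variable-suc u f u₀≈0 u₁≈1 u≈0 n = begin
    (u ⊛ f) (suc n)                       ≈⟨ ⊛-shift u f n ⟩
    u 0 * f (suc n) + (shift u ⊛ f) n     ≈⟨ +-cong (trans (*-congʳ u₀≈0) (zeroˡ _)) (⊛-constantˡ (shift u) f u≈0 n) ⟩
    0# + u 1 * f n                        ≈⟨ trans (+-identityˡ _) (*-congʳ u₁≈1) ⟩
    1# * f n                              ≈⟨ *-identityˡ _ ⟩
    f n                                   ∎

  ⊛-assoc : ∀ f g h → (f ⊛ g) ⊛ h ≋ f ⊛ (g ⊛ h)
  ⊛-assoc f g h zero = begin
    ((f ⊛ g) ⊛ h) 0     ≈⟨ trans (sum-0 _) (*-congʳ (sum-0 _)) ⟩
    (f 0 * g 0) * h 0   ≈⟨ *-assoc _ _ _ ⟩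
    f 0 * (g 0 * h 0)   ≈⟨ sym (trans (sum-0 _) (*-congˡ (sum-0 _))) ⟩
    (f ⊛ (g ⊛ h)) 0     ∎
  ⊛-assoc f g h (suc n) = begin
    ((f ⊛ g) ⊛ h) (suc n)
      ≈⟨ ⊛-shift (f ⊛ g) h n ⟩
    (f ⊛ g) 0 * h (suc n) + (shift (f ⊛ g) ⊛ h) n
      ≈⟨ +-cong (*-congʳ (sum-0 _)) (⊛-cong {g = h} {g′ = h} (⊛-shift f g) (λ _ → refl) n) ⟩
    (f 0 * g 0) * h (suc n) + ((f0·shift-g ⊕ shift f ⊛ g) ⊛ h) n
      ≈⟨ +-congˡ (⊛-distribʳ f0·shift-g (shift f ⊛ g) h n) ⟩
    (f 0 * g 0) * h (suc n) + ((f0·shift-g ⊛ h) n + ((shift f ⊛ g) ⊛ h) n)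
      ≈⟨ +-congˡ (+-cong (trans (sum-cong′ n (λ i → *-assoc _ _ _)) (sym (sum-*ˡ n (f 0) _))) (⊛-assoc (shift f) g h n)) ⟩
    (f 0 * g 0) * h (suc n) + (f 0 * (shift g ⊛ h) n + (shift f ⊛ (g ⊛ h)) n)
      ≈⟨ solve 5 (λ a b c d e → (a :* b) :* c :+ (a :* d :+ e) := a :* (b :* c :+ d) :+ e) refl _ _ _ _ _ ⟩
    f 0 * (g 0 * h (suc n) + (shift g ⊛ h) n) + (shift f ⊛ (g ⊛ h)) n
      ≈⟨ +-congʳ (*-congˡ (sym (⊛-shift g h n))) ⟩
    f 0 * (g ⊛ h) (suc n) + (shift f ⊛ (g ⊛ h)) n
      ≈⟨ sym (⊛-shift f (g ⊛ h) n) ⟩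
    (f ⊛ (g ⊛ h)) (suc n) ∎
    where
    open BaseSolver using (solve; _:+_; _:*_; _:=_)
    f0·shift-g : Series
    f0·shift-g m = f 0 * g (suc m)

  seriesRing : CommutativeRing c ℓ
  seriesRing = record
    { Carrier = Series ; _≈_ = _≋_ ; _+_ = _⊕_ ; _*_ = _⊛_ ; -_ = ⊖_ ; 0# = 𝟎 ; 1# = 𝟏
    ; isCommutativeRing = record
      { isRing = record
        { +-isAbelianGroup = record
          { isGroup = record
            { isMonoid = record
              { isSemigroup = record
                { isMagma = record
                  { isEquivalence = record { refl = λ _ → refl ; sym = λ p n → sym (p n) ; trans = λ p q n → trans (p n) (q n) }
                  ; ∙-cong = λ p q n → +-cong (p n) (q n) }
                ; assoc = λ f g h n → +-assoc _ _ _ }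
              ; identity = (λ f n → +-identityˡ _) , (λ f n → +-identityʳ _) }
            ; inverse = (λ f n → -‿inverseˡ _) , (λ f n → -‿inverseʳ _)
            ; ⁻¹-cong = λ p n → -‿cong (p n) }
          ; comm = λ f g n → +-comm _ _ }
        ; *-cong = ⊛-cong
        ; *-assoc = ⊛-assoc
        ; *-identity = ⊛-identityˡ , (λ g n → trans (⊛-comm g 𝟏 n) (⊛-identityˡ g n))
        ; distrib = (λ h f g → ⊛-distribˡ f g h) , (λ h f g → ⊛-distribʳ f g h) }
      ; *-comm = ⊛-comm } }

  unit-cancel : ∀ u v → v 0 ≈ 1# → u ⊛ v ≋ 𝟎 → u ≋ 𝟎
  unit-cancel u v v₀≈1 uv≈0 n = below n n ℕₚ.≤-refl
    where
    below : ∀ n i → i ≤ n → u i ≈ 0#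
    below zero zero z≤n = begin
      u 0            ≈⟨ sym (*-identityʳ _) ⟩
      u 0 * 1#       ≈⟨ *-congˡ (sym v₀≈1) ⟩
      u 0 * v 0      ≈⟨ sym (sum-0 _) ⟩
      (u ⊛ v) 0      ≈⟨ uv≈0 0 ⟩
      0#             ∎
    below (suc n) i i≤1+n with ℕₚ.m≤n⇒m<n∨m≡n i≤1+n
    ... | inj₁ i<1+n  = below n i (ℕₚ.m<1+n⇒m≤n i<1+n)
    ... | inj₂ ≡.refl = begin
      u (suc n)                           ≈⟨ sym (*-identityˡ _) ⟩
      1# * u (suc n)                      ≈⟨ *-congʳ (sym v₀≈1) ⟩
      v 0 * u (suc n)                     ≈⟨ sym (+-identityʳ _) ⟩
      v 0 * u (suc n) + 0#                ≈⟨ +-congˡ (sym (sum-vanish n (λ j _ → trans (*-congˡ (below n (n ∸ j) (ℕₚ.m∸n≤m n j))) (zeroʳ _)))) ⟩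
      v 0 * u (suc n) + (shift v ⊛ u) n   ≈⟨ sym (⊛-shift v u n) ⟩
      (v ⊛ u) (suc n)                     ≈⟨ ⊛-comm v u (suc n) ⟩
      (u ⊛ v) (suc n)                     ≈⟨ uv≈0 (suc n) ⟩
      0#                                  ∎

  -- The formal derivative (D f)_n = (n+1) f_{n+1}, over a ring in which
  -- multiplication by each positive integer is cancellable (as in any
  -- ℚ-algebra).
  module Derivative (cancel : ∀ n {a b} → (suc n × 1#) * a ≈ (suc n × 1#) * b → a ≈ b) where
    module S = CommutativeRing seriesRing
    module SeriesSolver = IntegerSolver seriesRing

    -- Euler operator (θ f)_n = n f_n; D is θ followed by shift.
    θ : Series → Series
    θ f n = (n × 1#) * f n

    D : Series → Series
    D f n = (suc n × 1#) * f (suc n)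

    θ-leibniz : ∀ f g → θ (f ⊛ g) ≋ θ f ⊛ g ⊕ f ⊛ θ g
    θ-leibniz f g n = begin
      (n × 1#) * sum n (λ i → f i * g (n ∸ i))     ≈⟨ sum-*ˡ n _ _ ⟩
      sum n (λ i → (n × 1#) * (f i * g (n ∸ i)))   ≈⟨ sum-cong n split ⟩
      sum n (λ i → θ f i * g (n ∸ i) + f i * θ g (n ∸ i)) ≈⟨ sum-+ n _ _ ⟩
      (θ f ⊛ g ⊕ f ⊛ θ g) n ∎
      where
      -- n = i + (n - i)
      split : ∀ i → i ≤ n → (n × 1#) * (f i * g (n ∸ i)) ≈ θ f i * g (n ∸ i) + f i * θ g (n ∸ i)
      split i i≤n = begin
        (n × 1#) * (f i * g (n ∸ i))
          ≈⟨ *-congʳ (trans (reflexive (≡.cong (_× 1#) (≡.sym (ℕₚ.m+[n∸m]≡n i≤n)))) (×-homo-+ 1# i (n ∸ i))) ⟩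
        (i × 1# + (n ∸ i) × 1#) * (f i * g (n ∸ i))
          ≈⟨ solve 4 (λ a b x y → (a :+ b) :* (x :* y) := (a :* x) :* y :+ x :* (b :* y)) refl _ _ _ _ ⟩
        θ f i * g (n ∸ i) + f i * θ g (n ∸ i) ∎
        where open BaseSolver using (solve; _:+_; _:*_; _:=_)

    D-cong : ∀ {f g} → f ≋ g → D f ≋ D g
    D-cong f≈g n = *-congˡ (f≈g (suc n))

    D-+ : ∀ f g → D (f ⊕ g) ≋ D f ⊕ D g
    D-+ f g n = distribˡ _ _ _

    D-⊖ : ∀ f → D (⊖ f) ≋ ⊖ D f
    D-⊖ f n = sym (-‿distribʳ-* _ _)

    D-cst : ∀ a → D (cst a) ≋ 𝟎
    D-cst a n = zeroʳ _

    D-𝟏 : D 𝟏 ≋ 𝟎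
    D-𝟏 n = trans (*-congˡ (𝟏-suc n)) (zeroʳ _)

    D-⊛ : ∀ f g → D (f ⊛ g) ≋ D f ⊛ g ⊕ f ⊛ D g
    D-⊛ f g n = begin
      θ (f ⊛ g) (suc n)                        ≈⟨ θ-leibniz f g (suc n) ⟩
      (θ f ⊛ g) (suc n) + (f ⊛ θ g) (suc n)    ≈⟨ +-cong (θ-shift f g) (trans (⊛-comm f (θ g) (suc n)) (trans (θ-shift g f) (⊛-comm (D g) f n))) ⟩
      (D f ⊛ g) n + (f ⊛ D g) n                ∎
      where
      -- θ f has zero constant term, so (θ f · g)_{n+1} = (D f · g)_n
      θ-shift : ∀ f g → (θ f ⊛ g) (suc n) ≈ (D f ⊛ g) n
      θ-shift f g = trans (⊛-shift (θ f) g n)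
        (trans (+-congʳ (trans (*-congʳ (zeroˡ _)) (zeroˡ _))) (+-identityˡ _))

    linear-ode-unique : ∀ A B c → D A ≋ A ⊕ c → D B ≋ B ⊕ c → A 0 ≈ B 0 → A ≋ B
    linear-ode-unique A B c A′ B′ A₀≈B₀ zero    = A₀≈B₀
    linear-ode-unique A B c A′ B′ A₀≈B₀ (suc n) = cancel n (begin
      D A n        ≈⟨ A′ n ⟩
      A n + c n    ≈⟨ +-congʳ (linear-ode-unique A B c A′ B′ A₀≈B₀ n) ⟩
      B n + c n    ≈⟨ sym (B′ n) ⟩
      D B n        ∎)

    -- If G₀ = 1, G'' = a G' + b G and h = G'/G, then h satisfies the
    -- Riccati equation h' + h² = a h + b: the difference W of the two sides
    -- satisfies W G = G'' - a G' - b G = 0, and G is not a zero divisor.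
    riccati : ∀ G h a b → G 0 ≈ 1# → h ⊛ G ≋ D G → D (D G) ≋ a ⊛ D G ⊕ b ⊛ G →
              D h ⊕ h ⊛ h ≋ a ⊛ h ⊕ b
    riccati G h a b G₀≈1 hG≈G′ G″ n = begin
      (D h ⊕ h ⊛ h) n                  ≈⟨ SeriesSolver.solve 2 (λ x y → x := (x :- y) :+ y) S.refl (D h ⊕ h ⊛ h) (a ⊛ h ⊕ b) n ⟩
      (W ⊕ (a ⊛ h ⊕ b)) n              ≈⟨ +-congʳ (W≈0 n) ⟩
      0# + (a ⊛ h ⊕ b) n               ≈⟨ +-identityˡ _ ⟩
      (a ⊛ h ⊕ b) n                    ∎
      where
      open SeriesSolver using (_:+_; _:*_; _:-_; _:=_)
      W : Series
      W = (D h ⊕ h ⊛ h) S.- (a ⊛ h ⊕ b)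
      WG≈0 : W ⊛ G ≋ 𝟎
      WG≈0 m = begin
        (W ⊛ G) m
          ≈⟨ SeriesSolver.solve 5 (λ d h a b g → ((d :+ h :* h) :- (a :* h :+ b)) :* g := (d :* g :+ h :* (h :* g)) :- (a :* (h :* g) :+ b :* g)) S.refl (D h) h a b G m ⟩
        ((D h ⊛ G ⊕ h ⊛ (h ⊛ G)) S.- (a ⊛ (h ⊛ G) ⊕ b ⊛ G)) m
          ≈⟨ +-cong (+-congˡ (⊛-cong (S.refl {h}) hG≈G′ m)) (-‿cong (+-congʳ (⊛-cong (S.refl {a}) hG≈G′ m))) ⟩
        ((D h ⊛ G ⊕ h ⊛ D G) S.- (a ⊛ D G ⊕ b ⊛ G)) m
          ≈⟨ +-cong (sym (D-⊛ h G m)) (-‿cong (sym (G″ m))) ⟩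
        (D (h ⊛ G) S.- D (D G)) m
          ≈⟨ +-congʳ (D-cong hG≈G′ m) ⟩
        (D (D G) S.- D (D G)) m
          ≈⟨ -‿inverseʳ _ ⟩
        0# ∎
      W≈0 : W ≋ 𝟎
      W≈0 = unit-cancel W G G₀≈1 WG≈0

    module Composition (ψ : Series) (ψ₀≈0 : ψ 0 ≈ 0#) where

      power : ℕ → Series
      power zero    = 𝟏
      power (suc k) = ψ ⊛ power k

      comp : Series → Series
      comp f n = sum n (λ k → f k * power k n)

      power-order : ∀ k n → n < k → power k n ≈ 0#
      power-order (suc k) n (s≤s n≤k) = sum-vanish n term
        where
        term : ∀ i → i ≤ n → ψ i * power k (n ∸ i) ≈ 0#
        term zero    _   = trans (*-congʳ ψ₀≈0) (zeroˡ _)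
        term (suc j) j<n = trans (*-congˡ (power-order k (n ∸ suc j)
          (ℕₚ.<-≤-trans (ℕₚ.∸-monoʳ-< {n} {suc j} {0} (s≤s z≤n) j<n) n≤k))) (zeroʳ _)

      partial : ℕ → Series → Series
      partial m f n = sum m (λ k → f k * power k n)

      comp-truncate : ∀ m f n → n ≤ m → comp f n ≈ partial m f n
      comp-truncate m f n n≤m = sym (sum-extend m _ n≤m (λ k n<k _ → trans (*-congˡ (power-order k n n<k)) (zeroʳ _)))

      comp-cong : ∀ {f g} → f ≋ g → comp f ≋ comp g
      comp-cong f≈g n = sum-cong′ n (λ k → *-congʳ (f≈g k))

      comp-⊕ : ∀ f g → comp (f ⊕ g) ≋ comp f ⊕ comp g
      comp-⊕ f g n = trans (sum-cong′ n (λ k → distribʳ _ _ _)) (sum-+ n _ _)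

      comp-constant-term : ∀ f → comp f 0 ≈ f 0
      comp-constant-term f = trans (sum-0 _) (trans (*-congˡ 𝟏-0) (*-identityʳ _))

      comp-cst : ∀ a → comp (cst a) ≋ cst a
      comp-cst a zero    = comp-constant-term (cst a)
      comp-cst a (suc n) = begin
        comp (cst a) (suc n)                                       ≈⟨ sum-head n _ ⟩
        a * 𝟏 (suc n) + sum n (λ k → 0# * power (suc k) (suc n))   ≈⟨ +-cong (trans (*-congˡ (𝟏-suc n)) (zeroʳ _)) (sum-vanish n (λ i _ → zeroˡ _)) ⟩
        0# + 0#                                                    ≈⟨ +-identityˡ _ ⟩
        0#                                                         ∎

      D-power : ∀ k n → D (power (suc k)) n ≈ (suc k × 1#) * (power k ⊛ D ψ) n
      D-power zero n = begin
        D (ψ ⊛ 𝟏) n                    ≈⟨ D-⊛ ψ 𝟏 n ⟩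
        (D ψ ⊛ 𝟏) n + (ψ ⊛ D 𝟏) n      ≈⟨ +-cong (⊛-comm (D ψ) 𝟏 n) (trans (⊛-cong (S.refl {ψ}) D-𝟏 n) (sum-vanish n (λ i _ → zeroʳ _))) ⟩
        (𝟏 ⊛ D ψ) n + 0#               ≈⟨ +-identityʳ _ ⟩
        (𝟏 ⊛ D ψ) n                    ≈⟨ sym (trans (*-congʳ (+-identityʳ 1#)) (*-identityˡ _)) ⟩
        (1 × 1#) * (𝟏 ⊛ D ψ) n         ∎
      D-power (suc k) n = begin
        D (ψ ⊛ power (suc k)) n
          ≈⟨ D-⊛ ψ (power (suc k)) n ⟩
        (D ψ ⊛ power (suc k)) n + (ψ ⊛ D (power (suc k))) n
          ≈⟨ +-cong (⊛-comm (D ψ) _ n) (⊛-congₙ n (λ _ _ → refl) (λ i _ → D-power k i)) ⟩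
        (power (suc k) ⊛ D ψ) n + sum n (λ i → ψ i * (m * (power k ⊛ D ψ) (n ∸ i)))
          ≈⟨ +-congˡ (trans (sum-cong′ n (λ i → x*[m*y]≈m*[x*y] _ _ _)) (sym (sum-*ˡ n m _))) ⟩
        (power (suc k) ⊛ D ψ) n + m * (ψ ⊛ (power k ⊛ D ψ)) n
          ≈⟨ +-congˡ (*-congˡ (sym (⊛-assoc ψ (power k) (D ψ) n))) ⟩
        (power (suc k) ⊛ D ψ) n + m * (power (suc k) ⊛ D ψ) n
          ≈⟨ trans (+-congʳ (sym (*-identityˡ _))) (sym (distribʳ _ _ _)) ⟩
        (1# + m) * (power (suc k) ⊛ D ψ) n
          ≈⟨ refl ⟩
        (suc (suc k) × 1#) * (power (suc k) ⊛ D ψ) n ∎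
        where
        m : Carrier
        m = suc k × 1#
        x*[m*y]≈m*[x*y] : ∀ x m y → x * (m * y) ≈ m * (x * y)
        x*[m*y]≈m*[x*y] x m y = trans (sym (*-assoc x m y)) (trans (*-congʳ (*-comm x m)) (*-assoc m x y))

      D-partial : ∀ m f n → D (partial (suc m) f) n ≈ (partial m (D f) ⊛ D ψ) n
      D-partial m f n = begin
        (suc n × 1#) * sum (suc m) (λ k → f k * power k (suc n))
          ≈⟨ trans (sum-*ˡ (suc m) _ _) (sum-head m _) ⟩
        (suc n × 1#) * (f 0 * 𝟏 (suc n)) + sum m (λ k → (suc n × 1#) * (f (suc k) * power (suc k) (suc n)))
          ≈⟨ +-cong (trans (*-congˡ (trans (*-congˡ (𝟏-suc n)) (zeroʳ _))) (zeroʳ _)) (sum-cong′ m term) ⟩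
        0# + sum m (λ k → D f k * (power k ⊛ D ψ) n)
          ≈⟨ trans (+-identityˡ _) (sum-cong′ m (λ k → sum-*ˡ n _ _)) ⟩
        sum m (λ k → sum n (λ i → D f k * (power k i * D ψ (n ∸ i))))
          ≈⟨ sum-swap m n _ ⟩
        sum n (λ i → sum m (λ k → D f k * (power k i * D ψ (n ∸ i))))
          ≈⟨ sum-cong′ n (λ i → trans (sum-cong′ m (λ k → sym (*-assoc _ _ _))) (sym (sum-*ʳ m _ _))) ⟩
        (partial m (D f) ⊛ D ψ) n ∎
        where
        term : ∀ k → (suc n × 1#) * (f (suc k) * power (suc k) (suc n)) ≈ D f k * (power k ⊛ D ψ) n
        term k = begin
          (suc n × 1#) * (f (suc k) * power (suc k) (suc n))   ≈⟨ solve 3 (λ a b c → a :* (b :* c) := b :* (a :* c)) refl _ _ _ ⟩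
          f (suc k) * D (power (suc k)) n                      ≈⟨ *-congˡ (D-power k n) ⟩
          f (suc k) * ((suc k × 1#) * (power k ⊛ D ψ) n)       ≈⟨ solve 3 (λ a b c → a :* (b :* c) := (b :* a) :* c) refl _ _ _ ⟩
          D f k * (power k ⊛ D ψ) n                            ∎
          where open BaseSolver using (solve; _:*_; _:=_)

      chain-rule : ∀ f → D (comp f) ≋ comp (D f) ⊛ D ψ
      chain-rule f n = begin
        (suc n × 1#) * comp f (suc n)   ≈⟨ *-congˡ (comp-truncate (suc n) f (suc n) ℕₚ.≤-refl) ⟩
        D (partial (suc n) f) n         ≈⟨ D-partial n f n ⟩
        (partial n (D f) ⊛ D ψ) n       ≈⟨ ⊛-congₙ n {g = D ψ} {g′ = D ψ} (λ i i≤n → sym (comp-truncate n (D f) i i≤n)) (λ _ _ → refl) ⟩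
        (comp (D f) ⊛ D ψ) n            ∎

      -- Proof by induction on the degree:
      -- the coefficient of degree n+1 is determined, after cancelling n+1,
      -- by the derivative, which the chain rule and the Leibniz rule express
      -- through coefficients of degree ≤ n.
      comp-⊛-upto : ∀ n f g i → i ≤ n → comp (f ⊛ g) i ≈ (comp f ⊛ comp g) i
      comp-⊛-upto zero f g zero z≤n = begin
        comp (f ⊛ g) 0          ≈⟨ trans (comp-constant-term _) (sum-0 _) ⟩
        f 0 * g 0               ≈⟨ sym (*-cong (comp-constant-term f) (comp-constant-term g)) ⟩
        comp f 0 * comp g 0     ≈⟨ sym (sum-0 _) ⟩
        (comp f ⊛ comp g) 0     ∎
      comp-⊛-upto (suc n) f g i i≤1+n with ℕₚ.m≤n⇒m<n∨m≡n i≤1+n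
      ... | inj₁ i<1+n  = comp-⊛-upto n f g i (ℕₚ.m<1+n⇒m≤n i<1+n)
      ... | inj₂ ≡.refl = cancel n (begin
        D (comp (f ⊛ g)) n
          ≈⟨ chain-rule (f ⊛ g) n ⟩
        (comp (D (f ⊛ g)) ⊛ D ψ) n
          ≈⟨ ⊛-cong {g = D ψ} {g′ = D ψ} (S.trans (comp-cong (D-⊛ f g)) (comp-⊕ (D f ⊛ g) (f ⊛ D g))) S.refl n ⟩
        ((comp (D f ⊛ g) ⊕ comp (f ⊛ D g)) ⊛ D ψ) n
          ≈⟨ ⊛-congₙ n {g = D ψ} {g′ = D ψ} (λ j j≤n → +-cong (comp-⊛-upto n (D f) g j j≤n) (comp-⊛-upto n f (D g) j j≤n)) (λ _ _ → refl) ⟩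
        ((comp (D f) ⊛ comp g ⊕ comp f ⊛ comp (D g)) ⊛ D ψ) n
          ≈⟨ SeriesSolver.solve 5 (λ a b c d e → (a :* b :+ c :* d) :* e := (a :* e) :* b :+ c :* (d :* e)) S.refl (comp (D f)) (comp g) (comp f) (comp (D g)) (D ψ) n ⟩
        ((comp (D f) ⊛ D ψ) ⊛ comp g ⊕ comp f ⊛ (comp (D g) ⊛ D ψ)) n
          ≈⟨ +-cong (⊛-cong (S.sym (chain-rule f)) (S.refl {comp g}) n) (⊛-cong (S.refl {comp f}) (S.sym (chain-rule g)) n) ⟩
        (D (comp f) ⊛ comp g ⊕ comp f ⊛ D (comp g)) n
          ≈⟨ sym (D-⊛ (comp f) (comp g) n) ⟩
        D (comp f ⊛ comp g) n ∎)
        where open SeriesSolver using (_:+_; _:*_; _:=_)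

      comp-⊛ : ∀ f g → comp (f ⊛ g) ≋ comp f ⊛ comp g
      comp-⊛ f g n = comp-⊛-upto n f g n ℕₚ.≤-refl

      -- If q' = q² + c q for a constant c, and ψ' (q ∘ ψ) = 1 (ψ inverts a
      -- primitive of q), then Q = q ∘ ψ satisfies the linear equation
      -- Q' = Q + c: indeed Q' = (q' ∘ ψ) ψ' = (Q² + c Q) ψ'.
      composed-ode : ∀ q a → D q ≋ q ⊛ q ⊕ cst a ⊛ q → comp q ⊛ D ψ ≋ 𝟏 →
                     D (comp q) ≋ comp q ⊕ cst a
      composed-ode q a q′ Qψ′≈1 n = begin
        D Q n
          ≈⟨ chain-rule q n ⟩
        (comp (D q) ⊛ D ψ) n
          ≈⟨ ⊛-cong (S.trans (comp-cong q′) (comp-⊕ (q ⊛ q) (cst a ⊛ q))) (S.refl {D ψ}) n ⟩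
        ((comp (q ⊛ q) ⊕ comp (cst a ⊛ q)) ⊛ D ψ) n
          ≈⟨ ⊛-cong (S.+-cong (comp-⊛ q q) (S.trans (comp-⊛ (cst a) q) (⊛-cong (comp-cst a) (S.refl {Q})))) (S.refl {D ψ}) n ⟩
        ((Q ⊛ Q ⊕ cst a ⊛ Q) ⊛ D ψ) n
          ≈⟨ SeriesSolver.solve 3 (λ x y z → (x :* x :+ y :* x) :* z := x :* (x :* z) :+ y :* (x :* z)) S.refl Q (cst a) (D ψ) n ⟩
        (Q ⊛ (Q ⊛ D ψ) ⊕ cst a ⊛ (Q ⊛ D ψ)) n
          ≈⟨ +-cong (⊛-cong (S.refl {Q}) Qψ′≈1 n) (⊛-cong (S.refl {cst a}) Qψ′≈1 n) ⟩
        (Q ⊛ 𝟏 ⊕ cst a ⊛ 𝟏) n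
          ≈⟨ +-cong (S.*-identityʳ Q n) (S.*-identityʳ (cst a) n) ⟩
        (Q ⊕ cst a) n ∎
        where
        open SeriesSolver using (_:+_; _:*_; _:=_)
        Q : Series
        Q = comp q

-- With the sums of `Defs` the
-- generic operations coincide definitionally with those of `Defs`.
open import Defs
open import Data.Rational as ℚ using (ℚ; 0ℚ; 1ℚ)
import Data.Rational.Properties as ℚₚ
open RationalArithmetic

module ℚ[[r]] = PowerSeries ℚₚ.+-*-commutativeRing sumQ (λ _ → ≡.refl) (λ _ _ → ≡.refl) 1ᶜ ≡.refl (λ _ → ≡.refl)

coefRing : CommutativeRing _ _
coefRing = ℚ[[r]].seriesRing

module C = CommutativeRing coefRing
module CoefSolver = IntegerSolver coefRing

module ℚ[[r]][[x]] = PowerSeries coefRing sumC (λ _ _ → ≡.refl) (λ _ _ _ → ≡.refl) 𝟙 (λ _ → ≡.refl) (λ _ _ → ≡.refl)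

fpsRing : CommutativeRing _ _
fpsRing = ℚ[[r]][[x]].seriesRing

module F = CommutativeRing fpsRing
module FPSSolver = IntegerSolver fpsRing

open import Algebra.Properties.Semiring.Mult C.semiring using (_×_; ×-congʳ; ×-assoc-*)

infix 4 _≐_
_≐_ : Coef → Coef → Set
_≐_ = C._≈_

×-scalar : ∀ m a → (m × a) ≐ (N m ·ᶜ a)
×-scalar zero    a k = ≡.sym (ℚₚ.*-zeroˡ (a k))
×-scalar (suc m) a k = begin
  a k ℚ.+ (m × a) k          ≡⟨ ≡.cong (a k ℚ.+_) (×-scalar m a k) ⟩
  a k ℚ.+ N m ℚ.* a k        ≡⟨ ≡.cong (ℚ._+ N m ℚ.* a k) (≡.sym (ℚₚ.*-identityˡ (a k))) ⟩
  1ℚ ℚ.* a k ℚ.+ N m ℚ.* a k ≡⟨ ≡.sym (ℚₚ.*-distribʳ-+ (a k) 1ℚ (N m)) ⟩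
  (1ℚ ℚ.+ N m) ℚ.* a k       ≡⟨ ≡.cong (ℚ._* a k) (≡.sym (N-+ 1 m)) ⟩
  N (suc m) ℚ.* a k          ∎
  where open ≡.≡-Reasoning

×1-scalar : ∀ m a → ((m × 1ᶜ) *ᶜ a) ≐ (N m ·ᶜ a)
×1-scalar m a = C.trans (×-assoc-* m 1ᶜ a) (C.trans (×-congʳ m (C.*-identityˡ a)) (×-scalar m a))

-- ℚ[[r]] is a ℚ-algebra, so positive integers cancel
×1-cancel : ∀ n {a b} → ((suc n × 1ᶜ) *ᶜ a) ≐ ((suc n × 1ᶜ) *ᶜ b) → a ≐ b
×1-cancel n {a} {b} eq k = N-suc-cancel n (≡.trans (≡.sym (×1-scalar (suc n) a k)) (≡.trans (eq k) (×1-scalar (suc n) b k)))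

open ℚ[[r]][[x]] using (shift; cst; ⊛-constantˡ; ⊛-variable-0; ⊛-variable-suc)
open ℚ[[r]][[x]].Derivative ×1-cancel using (D-cong; D-+; D-⊖; D-⊛; D-𝟏; D-cst; linear-ode-unique; riccati; module Composition)
  renaming (D to ∂)

D≈∂ : ∀ f → D f ≈ ∂ f
D≈∂ f n = C.sym (×1-scalar (suc n) (f (suc n)))

X*-0 : ∀ u → (X * u) 0 ≐ 0ᶜ
X*-0 u = ⊛-variable-0 X u (λ _ → ≡.refl)

X*-suc : ∀ u n → (X * u) (suc n) ≐ u n
X*-suc u = ⊛-variable-suc X u (λ _ → ≡.refl) (λ _ → ≡.refl) (λ _ _ → ≡.refl)

minus-X*-0 : ∀ f u → (f - X * u) 0 ≐ f 0
minus-X*-0 f u = C.trans (C.+-congˡ {f 0} (C.trans (C.-‿cong (X*-0 u)) (λ _ → ≡.refl))) (C.+-identityʳ (f 0))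

minus-X*-suc : ∀ f u n → (f - X * u) (suc n) ≐ (f (suc n) +ᶜ (-ᶜ u n))
minus-X*-suc f u n = C.+-congˡ {f (suc n)} (C.-‿cong (X*-suc u n))

[1+r]* : ∀ f n → ((𝟙 + R) * f) n ≐ ((1ᶜ +ᶜ rᶜ) *ᶜ f n)
[1+r]* f = ⊛-constantˡ (𝟙 + R) f (λ _ _ → ≡.refl)

r* : ∀ f n → (R * f) n ≐ (rᶜ *ᶜ f n)
r* f = ⊛-constantˡ R f (λ _ _ → ≡.refl)

-- The hypothesis g (1 - x)(1 - r x) = 1 - (1 + r) x, rewritten as
-- g - x U = 1 - x (1 + r) with U = (1 + r) g - r x g, so that its
-- coefficients can be read off with the lemmas above.
module Denominator (g : FPS) (hg : g * ((𝟙 - X) * (𝟙 - R * X)) ≈ 𝟙 - (𝟙 + R) * X) where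
  open CoefSolver using (solve; _:+_; _:*_; :-_; _:-_; _:=_; :0; :1)
  open import Relation.Binary.Reasoning.Setoid C.setoid

  U : FPS
  U = (𝟙 + R) * g - X * (R * g)

  shifted-form : g - X * U ≈ 𝟙 - X * (𝟙 + R)
  shifted-form = F.trans expand (F.trans hg (F.+-congˡ {𝟙} (F.-‿cong (F.*-comm (𝟙 + R) X))))
    where
    open FPSSolver renaming (solve to solveₓ; _:+_ to _⊹_; _:*_ to _⋆_; _:-_ to _∸ₓ_; _:=_ to _≐ₓ_; :1 to 𝟙ₓ)
    expand : g - X * U ≈ g * ((𝟙 - X) * (𝟙 - R * X))
    expand = solveₓ 3 (λ g x r → g ∸ₓ x ⋆ ((𝟙ₓ ⊹ r) ⋆ g ∸ₓ x ⋆ (r ⋆ g)) ≐ₓ g ⋆ ((𝟙ₓ ∸ₓ x) ⋆ (𝟙ₓ ∸ₓ r ⋆ x))) F.refl g X R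

  U-0 : U 0 ≐ ((1ᶜ +ᶜ rᶜ) *ᶜ g 0)
  U-0 = C.trans (minus-X*-0 ((𝟙 + R) * g) (R * g)) ([1+r]* g 0)

  U-suc : ∀ n → U (suc n) ≐ (((1ᶜ +ᶜ rᶜ) *ᶜ g (suc n)) +ᶜ (-ᶜ (rᶜ *ᶜ g n)))
  U-suc n = C.trans (minus-X*-suc ((𝟙 + R) * g) (R * g) n) (C.+-cong ([1+r]* g (suc n)) (C.-‿cong (r* g n)))

  g₀≈1 : g 0 ≐ 1ᶜ
  g₀≈1 = begin
    g 0                         ≈⟨ C.sym (minus-X*-0 g U) ⟩
    (g - X * U) 0               ≈⟨ shifted-form 0 ⟩
    (𝟙 - X * (𝟙 + R)) 0         ≈⟨ minus-X*-0 𝟙 (𝟙 + R) ⟩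
    1ᶜ                          ∎

  -- the coefficient of x:  g₁ - (1 + r) g₀ = -(1 + r)
  g₁≈0 : g 1 ≐ 0ᶜ
  g₁≈0 = begin
    g 1
      ≈⟨ solve 3 (λ a s b → a := (a :- s :* b) :+ s :* b) C.refl (g 1) (1ᶜ +ᶜ rᶜ) (g 0) ⟩
    (g 1 +ᶜ (-ᶜ ((1ᶜ +ᶜ rᶜ) *ᶜ g 0))) +ᶜ ((1ᶜ +ᶜ rᶜ) *ᶜ g 0)
      ≈⟨ C.+-cong (C.trans (C.+-congˡ {g 1} (C.-‿cong (C.sym U-0))) coefficient-1) (C.*-congˡ {1ᶜ +ᶜ rᶜ} g₀≈1) ⟩
    (0ᶜ +ᶜ (-ᶜ (1ᶜ +ᶜ rᶜ))) +ᶜ ((1ᶜ +ᶜ rᶜ) *ᶜ 1ᶜ)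
      ≈⟨ solve 1 (λ r → (:0 :+ (:- (:1 :+ r))) :+ (:1 :+ r) :* :1 := :0) C.refl rᶜ ⟩
    0ᶜ ∎
    where
    coefficient-1 : (g 1 +ᶜ (-ᶜ U 0)) ≐ (0ᶜ +ᶜ (-ᶜ (1ᶜ +ᶜ rᶜ)))
    coefficient-1 = C.trans (C.sym (minus-X*-suc g U 0))
      (C.trans (shifted-form 1) (minus-X*-suc 𝟙 (𝟙 + R) 0))

  g-recurrence : ∀ n → g (suc (suc n)) ≐ (((1ᶜ +ᶜ rᶜ) *ᶜ g (suc n)) +ᶜ ((-ᶜ rᶜ) *ᶜ g n))
  g-recurrence n = begin
    g (suc (suc n))
      ≈⟨ solve 2 (λ a u → a := (a :- u) :+ u) C.refl (g (suc (suc n))) (U (suc n)) ⟩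
    (g (suc (suc n)) +ᶜ (-ᶜ U (suc n))) +ᶜ U (suc n)
      ≈⟨ C.+-cong coefficient-n+2 (U-suc n) ⟩
    (0ᶜ +ᶜ (-ᶜ 0ᶜ)) +ᶜ (((1ᶜ +ᶜ rᶜ) *ᶜ g (suc n)) +ᶜ (-ᶜ (rᶜ *ᶜ g n)))
      ≈⟨ solve 3 (λ r a b → (:0 :+ (:- :0)) :+ ((:1 :+ r) :* a :+ (:- (r :* b))) := (:1 :+ r) :* a :+ (:- r) :* b) C.refl rᶜ (g (suc n)) (g n) ⟩
    ((1ᶜ +ᶜ rᶜ) *ᶜ g (suc n)) +ᶜ ((-ᶜ rᶜ) *ᶜ g n) ∎
    where
    coefficient-n+2 : (g (suc (suc n)) +ᶜ (-ᶜ U (suc n))) ≐ (0ᶜ +ᶜ (-ᶜ 0ᶜ))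
    coefficient-n+2 = C.trans (C.sym (minus-X*-suc g U (suc n)))
      (C.trans (shifted-form (suc (suc n))) (minus-X*-suc 𝟙 (𝟙 + R) (suc n)))

scalar-as-product : ∀ q u → (q ·ᶜ u) ≐ ((q ·ᶜ 1ᶜ) *ᶜ u)
scalar-as-product q u k = ≡.sym (≡.trans (ℚ[[r]].⊛-constantˡ (q ·ᶜ 1ᶜ) u (λ _ → ℚₚ.*-zeroʳ q) k)
                                         (≡.cong (ℚ._* u k) (ℚₚ.*-identityʳ q)))

-- The Borel transform turns the shift into the derivative:
-- (Σ g_n tⁿ/n!)' = Σ g_{n+1} tⁿ/n!, since (n+1)·1/(n+1)! = 1/n!.
D-borel : ∀ f → D (borel f) ≈ borel (shift f)
D-borel f n k = begin
  N (suc n) ℚ.* (invFact (suc n) ℚ.* f (suc n) k)   ≡⟨ ≡.sym (ℚₚ.*-assoc (N (suc n)) _ _) ⟩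
  (N (suc n) ℚ.* invFact (suc n)) ℚ.* f (suc n) k   ≡⟨ ≡.cong (ℚ._* f (suc n) k) (N*reciprocal (suc n) (suc n ℕ.!) (n ℕ.!) {{suc n ℕₚ.!≢0}} {{n ℕₚ.!≢0}} ≡.refl) ⟩
  invFact n ℚ.* f (suc n) k                         ∎
  where open ≡.≡-Reasoning

∂-borel : ∀ f → ∂ (borel f) ≈ borel (shift f)
∂-borel f = F.trans (F.sym (D≈∂ (borel f))) (D-borel f)

borel-ode : ∀ g a b → (∀ n → g (suc (suc n)) ≐ ((a *ᶜ g (suc n)) +ᶜ (b *ᶜ g n))) →
            ∂ (∂ (borel g)) ≈ const a * ∂ (borel g) + const b * borel g
borel-ode g a b recurrence n = begin
  ∂ (∂ G) n                                                        ≈⟨ F.trans (D-cong (∂-borel g)) (∂-borel (shift g)) n ⟩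
  invFact n ·ᶜ g (suc (suc n))                                     ≈⟨ scalar-as-product (invFact n) _ ⟩
  ι *ᶜ g (suc (suc n))                                             ≈⟨ C.*-congˡ {ι} (recurrence n) ⟩
  ι *ᶜ ((a *ᶜ g (suc n)) +ᶜ (b *ᶜ g n))                            ≈⟨ solve 5 (λ i a b u v → i :* (a :* u :+ b :* v) := a :* (i :* u) :+ b :* (i :* v)) C.refl ι a b (g (suc n)) (g n) ⟩
  (a *ᶜ (ι *ᶜ g (suc n))) +ᶜ (b *ᶜ (ι *ᶜ g n))                      ≈⟨ C.sym (C.+-cong (C.*-congˡ {a} (C.trans (∂-borel g n) (scalar-as-product (invFact n) (g (suc n)))))
                                                                                       (C.*-congˡ {b} (scalar-as-product (invFact n) (g n)))) ⟩
  (a *ᶜ ∂ G n) +ᶜ (b *ᶜ G n)                                        ≈⟨ C.sym (C.+-cong (⊛-constantˡ (const a) (∂ G) (λ _ _ → ≡.refl) n) (⊛-constantˡ (const b) G (λ _ _ → ≡.refl) n)) ⟩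
  (const a * ∂ G + const b * G) n                                  ∎
  where
  open import Relation.Binary.Reasoning.Setoid C.setoid
  open CoefSolver using (solve; _:+_; _:*_; _:=_)
  G : FPS
  G = borel g
  ι : Coef
  ι = invFact n ·ᶜ 1ᶜ

-- Steps (1)-(2) of the pipeline: G is the Borel transform of g and
-- h = G'/G.  Then q = 1 - h satisfies q' = q² + (r - 1) q.
module LogarithmicDerivative (g : FPS) (hg : g * ((𝟙 - X) * (𝟙 - R * X)) ≈ 𝟙 - (𝟙 + R) * X)
                             (h : FPS) (hh : h * borel g ≈ D (borel g)) where
  open Denominator g hg using (g₀≈1; g₁≈0; g-recurrence)

  G : FPS
  G = borel g

  G₀≈1 : G 0 ≐ 1ᶜ
  G₀≈1 k = ≡.trans (ℚₚ.*-identityˡ (g 0 k)) (g₀≈1 k)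

  G-ode : ∂ (∂ G) ≈ (𝟙 + R) * ∂ G + (- R) * G
  G-ode = F.trans (borel-ode g (1ᶜ +ᶜ rᶜ) (-ᶜ rᶜ) g-recurrence)
                  (F.+-cong (F.*-congʳ {∂ G} 1+r-constant) (F.*-congʳ {G} -r-constant))
    where
    1+r-constant : const (1ᶜ +ᶜ rᶜ) ≈ 𝟙 + R
    1+r-constant zero    _ = ≡.refl
    1+r-constant (suc _) _ = ≡.refl
    -r-constant : const (-ᶜ rᶜ) ≈ - R
    -r-constant zero    _ = ≡.refl
    -r-constant (suc _) _ = ≡.refl

  h-riccati : ∂ h + h * h ≈ (𝟙 + R) * h + (- R)
  h-riccati = riccati G h (𝟙 + R) (- R) G₀≈1 (F.trans hh (D≈∂ G)) G-ode

  -- h₀ G₀ = G'₀ = g₁ = 0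
  h₀≈0 : h 0 ≐ 0ᶜ
  h₀≈0 = begin
    h 0              ≈⟨ C.sym (C.*-identityʳ (h 0)) ⟩
    h 0 *ᶜ 1ᶜ        ≈⟨ C.*-congˡ {h 0} (C.sym G₀≈1) ⟩
    (h * G) 0        ≈⟨ hh 0 ⟩
    D G 0            ≈⟨ D-borel g 0 ⟩
    invFact 0 ·ᶜ g 1 ≈⟨ (λ k → ≡.trans (≡.cong (invFact 0 ℚ.*_) (g₁≈0 k)) (ℚₚ.*-zeroʳ (invFact 0))) ⟩
    0ᶜ               ∎
    where open import Relation.Binary.Reasoning.Setoid C.setoid

  q : FPS
  q = 𝟙 - h

  q-ode : ∂ q ≈ q * q + (R - 𝟙) * q
  q-ode = begin
    ∂ (𝟙 - h)                         ≈⟨ F.trans (D-+ 𝟙 (- h)) (F.+-cong D-𝟏 (D-⊖ h)) ⟩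
    F.0# + - ∂ h                      ≈⟨ solve 2 (λ d y → :0 :+ (:- d) := y :- (d :+ y)) F.refl (∂ h) (h * h) ⟩
    h * h - (∂ h + h * h)             ≈⟨ F.+-congˡ {h * h} (F.-‿cong h-riccati) ⟩
    h * h - ((𝟙 + R) * h + (- R))     ≈⟨ solve 2 (λ y r → y :* y :- ((:1 :+ r) :* y :+ (:- r)) := (:1 :- y) :* (:1 :- y) :+ (r :- :1) :* (:1 :- y)) F.refl h R ⟩
    q * q + (R - 𝟙) * q               ∎
    where
    open import Relation.Binary.Reasoning.Setoid F.setoid
    open FPSSolver using (solve; _:+_; _:*_; :-_; _:-_; _:=_; :0; :1)

-- ∫ is a right inverse of the derivative, since (n+1)·1/(n+1) = 1.
D-∫ : ∀ f → D (∫ f) ≈ f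
D-∫ f n k = begin
  N (suc n) ℚ.* (invSuc n ℚ.* f n k)   ≡⟨ ≡.sym (ℚₚ.*-assoc (N (suc n)) _ _) ⟩
  (N (suc n) ℚ.* invSuc n) ℚ.* f n k   ≡⟨ ≡.cong (ℚ._* f n k) (N*reciprocal (suc n) (suc n) 1 (ℕₚ.*-identityʳ (suc n))) ⟩
  1ℚ ℚ.* f n k                         ≡⟨ ℚₚ.*-identityˡ (f n k) ⟩
  f n k                                ∎
  where open ≡.≡-Reasoning

∂X≈𝟙 : ∂ X ≈ 𝟙
∂X≈𝟙 = F.trans (F.sym (D≈∂ X)) D-X
  where
  D-X : D X ≈ 𝟙
  D-X zero    k = ℚₚ.*-identityˡ (1ᶜ k)
  D-X (suc n) k = ℚₚ.*-zeroʳ (N (suc (suc n)))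

-- Steps (3)-(4) of the pipeline: φ = ∫ q has compositional inverse ψ.
-- Then Q = q ∘ ψ = φ' ∘ ψ satisfies Q ψ' = (φ ∘ ψ)' = 1, and if q solves
-- q' = q² + (r - 1) q then Q solves Q' = Q + (r - 1).
module Inversion (q ψ : FPS) (ψ₀≈0 : ∀ k → ψ 0 k ≡ 0ℚ) (hψ : (∫ q ∘ₛ ψ) ≈ X) where
  open Composition ψ ψ₀≈0 using (power; comp; comp-cong; chain-rule; composed-ode; comp-constant-term)

  power≈^ : ∀ k → power k ≈ ψ ^ k
  power≈^ zero    = F.refl
  power≈^ (suc k) = F.*-congˡ {ψ} (power≈^ k)

  comp≈∘ₛ : ∀ f → comp f ≈ (f ∘ₛ ψ)
  comp≈∘ₛ f n = ℚ[[r]][[x]].sum-cong′ n (λ k → C.*-congˡ {f k} (power≈^ k n))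

  Q : FPS
  Q = comp q

  Q₀≈q₀ : Q 0 ≐ q 0
  Q₀≈q₀ = comp-constant-term q

  Q*ψ′≈𝟙 : Q * ∂ ψ ≈ 𝟙
  Q*ψ′≈𝟙 = begin
    comp q * ∂ ψ              ≈⟨ F.*-congʳ {∂ ψ} (comp-cong (F.sym (F.trans (F.sym (D≈∂ (∫ q))) (D-∫ q)))) ⟩
    comp (∂ (∫ q)) * ∂ ψ      ≈⟨ F.sym (chain-rule (∫ q)) ⟩
    ∂ (comp (∫ q))            ≈⟨ D-cong (F.trans (comp≈∘ₛ (∫ q)) hψ) ⟩
    ∂ X                       ≈⟨ ∂X≈𝟙 ⟩
    𝟙                         ∎
    where open import Relation.Binary.Reasoning.Setoid F.setoid

  Q-ode : ∂ q ≈ q * q + (R - 𝟙) * q → ∂ Q ≈ Q + (R - 𝟙)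
  Q-ode q′ = F.trans (composed-ode q (rᶜ +ᶜ (-ᶜ 1ᶜ)) (F.trans q′ (F.+-congˡ {q * q} (F.*-congʳ {q} R-𝟙≈cst))) Q*ψ′≈𝟙)
                     (F.+-congˡ {Q} (F.sym R-𝟙≈cst))
    where
    R-𝟙≈cst : R - 𝟙 ≈ cst (rᶜ +ᶜ (-ᶜ 1ᶜ))
    R-𝟙≈cst zero    _ = ≡.refl
    R-𝟙≈cst (suc _) _ = ≡.refl

-- The right-hand side E = 1 + r (eˣ - 1) of the theorem (the reciprocal of
-- 1/(1 + r(eˣ - 1))) solves the same equation E' = r eˣ = E + (r - 1).
E : FPS
E = 𝟙 + R * (expX - 𝟙)

∂-exp : ∂ expX ≈ expX
∂-exp = ∂-borel (λ _ → 1ᶜ)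

E-ode : ∂ E ≈ E + (R - 𝟙)
E-ode = begin
  ∂ (𝟙 + R * (expX - 𝟙))
    ≈⟨ F.trans (D-+ 𝟙 (R * (expX - 𝟙))) (F.+-congˡ {∂ 𝟙} (D-⊛ R (expX - 𝟙))) ⟩
  ∂ 𝟙 + (∂ R * (expX - 𝟙) + R * ∂ (expX - 𝟙))
    ≈⟨ F.+-cong D-𝟏 (F.+-cong (F.*-congʳ {expX - 𝟙} (D-cst rᶜ)) (F.*-congˡ {R} (F.trans (D-+ expX (- 𝟙)) (F.+-cong ∂-exp (F.trans (D-⊖ 𝟙) (F.-‿cong D-𝟏)))))) ⟩
  F.0# + (F.0# * (expX - 𝟙) + R * (expX - F.0#))
    ≈⟨ solve 2 (λ r e → :0 :+ (:0 :* (e :- :1) :+ r :* (e :- :0)) := (:1 :+ r :* (e :- :1)) :+ (r :- :1)) F.refl R expX ⟩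
  E + (R - 𝟙) ∎
  where
  open import Relation.Binary.Reasoning.Setoid F.setoid
  open FPSSolver using (solve; _:+_; _:*_; _:-_; _:=_; :0; :1)

E₀≈1 : E 0 ≐ 1ᶜ
E₀≈1 = C.trans (C.+-congˡ {1ᶜ} (C.trans (C.*-congˡ {rᶜ} e₀-1≈0) (C.zeroʳ rᶜ))) (C.+-identityʳ 1ᶜ)
  where
  e₀-1≈0 : (expX - 𝟙) 0 ≐ 0ᶜ
  e₀-1≈0 = C.trans (C.+-congʳ { -ᶜ 1ᶜ} (λ k → ℚₚ.*-identityˡ (1ᶜ k))) (C.-‿inverseʳ 1ᶜ)

-- The theorem: with Q = (1 - h) ∘ ψ, both Q and E solve Q' = Q + (r - 1)
-- with constant term 1 (as h₀ = 0), hence Q = E, and ψ' E = ψ' Q = 1.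
mainTheorem6 :
    (g : FPS) → g * ((𝟙 - X) * (𝟙 - R * X)) ≈ 𝟙 - (𝟙 + R) * X →
    (h : FPS) → h * borel g ≈ D (borel g) →
    (ψ : FPS) → (∀ k → ψ 0 k ≡ 0ℚ) → (∫ (𝟙 - h) ∘ₛ ψ) ≈ X →
    D ψ * (𝟙 + R * (expX - 𝟙)) ≈ 𝟙
mainTheorem6 g hg h hh ψ ψ₀≈0 hψ = begin
  D ψ * E    ≈⟨ F.*-congʳ {E} (D≈∂ ψ) ⟩
  ∂ ψ * E    ≈⟨ F.*-congˡ {∂ ψ} (F.sym Q≈E) ⟩
  ∂ ψ * Q    ≈⟨ F.*-comm (∂ ψ) Q ⟩
  Q * ∂ ψ    ≈⟨ Q*ψ′≈𝟙 ⟩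
  𝟙          ∎
  where
  open import Relation.Binary.Reasoning.Setoid F.setoid
  open LogarithmicDerivative g hg h hh using (q; q-ode; h₀≈0)
  open Inversion q ψ ψ₀≈0 hψ using (Q; Q*ψ′≈𝟙; Q-ode; Q₀≈q₀)

  Q₀≈E₀ : Q 0 ≐ E 0
  Q₀≈E₀ = C.trans Q₀≈q₀ (C.trans (C.+-congˡ {1ᶜ} (C.trans (C.-‿cong h₀≈0) -0≈0)) (C.trans (C.+-identityʳ 1ᶜ) (C.sym E₀≈1)))
    where
    -0≈0 : (-ᶜ 0ᶜ) ≐ 0ᶜ
    -0≈0 _ = ≡.refl

  Q≈E : Q ≈ E
  Q≈E = linear-ode-unique Q E (R - 𝟙) (Q-ode q-ode) E-ode Q₀≈E₀
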